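{- Let $X$ be a type and $f:X\to X$. Suppose there exist a type $A$, maps $r:X\to A$ and $s:A\to X$, and homotopies $H:\prod_{a:A}(r(s(a))=a)$ and $K:\prod_{x:X}(s(r(x))=f(x))$. Then there exist $I:\prod_{x:X}(f(f(x))=f(x))$ and $J:\prod_{x:X}(\mathsf{ap}_f(I(x))=I(f(x)))$. That is, $f$ is quasi-idempotent.
   Context: Intensional Martin-Löf type theory. $\mathsf{ap}_f$ denotes the action of $f$ on paths. -}

{-# OPTIONS --without-K #-}
module Defs where

open import Data.Product using (Σ)
open import Relation.Binary.PropositionalEquality using (_≡_; cong)

IsQuasiIdempotent : ∀ {ℓ} {X : Set ℓ} → (X → X) → Set ℓ
IsQuasiIdempotent {X = X} f =
  Σ ((x : X) → f (f x) ≡ f x) (λ I → (x : X) → cong f (I x) ≡ I (f x))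

{-# OPTIONS --without-K #-}
module Submission where

-- The proof splits into two independent facts:
--
--   * retract-quasiIdempotent: s ∘ r itself is quasi-idempotent, with
--     I x = ap_s (H (r x)); the coherence is the standard identity
--     H (r (s a)) = ap_{r ∘ s} (H a) for a homotopy r ∘ s ~ id.
--   * quasiIdempotent-homotopy: quasi-idempotence is invariant under
--     homotopy.  The new I is the old one conjugated by K, and the new J
--     follows from naturality of K and of the old I.

open import Defs
open import Level using (Level)
open import Data.Product using (Σ; _×_; _,_)
open import Function using (_∘_)
open import Relation.Binary.PropositionalEquality
  using (_≡_; refl; sym; trans; cong; cong₂; cong-≡id; module ≡-Reasoning)
open import Relation.Binary.PropositionalEquality.Properties
  using (trans-reflʳ; trans-assoc; trans-symˡ; trans-cong; cong-∘)

private
  variable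
    a b : Level
    A B : Set a

conj : {x x' y y' : A} → x ≡ x' → y ≡ y' → x ≡ y → x' ≡ y'
conj α β e = trans (sym α) (trans e β)

cong-conj : (h : A → B) {x x' y y' : A} (α : x ≡ x') (β : y ≡ y') (e : x ≡ y) →
            cong h (conj α β e) ≡ conj (cong h α) (cong h β) (cong h e)
cong-conj h refl refl refl = refl

conj-conj : {x x' x'' y y' y'' : A}
            (α : x' ≡ x'') (β : y' ≡ y'') (α' : x ≡ x') (β' : y ≡ y') (e : x ≡ y) →
            conj α β (conj α' β' e) ≡ conj (trans α' α) (trans β' β) e
conj-conj refl refl refl refl refl = refl

cong-homotopic : {u v : A → B} (h : ∀ x → u x ≡ v x) {x y : A} (p : x ≡ y) →
                 cong v p ≡ conj (h x) (h y) (cong u p)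
cong-homotopic h {x} refl = sym (trans-symˡ (h x))

homotopy-along : {u v : A → B} (h : ∀ x → u x ≡ v x) {x y : A} (p : x ≡ y) →
                 h y ≡ conj (cong u p) (cong v p) (h x)
homotopy-along h {x} refl = sym (trans-reflʳ (h x))

retract-quasiIdempotent : {X : Set a} {A : Set b} (r : X → A) (s : A → X) →
                          (∀ y → r (s y) ≡ y) → IsQuasiIdempotent (s ∘ r)
retract-quasiIdempotent r s H = I , J
  where
  I : ∀ x → s (r (s (r x))) ≡ s (r x)
  I x = cong s (H (r x))

  J : ∀ x → cong (s ∘ r) (I x) ≡ I (s (r x))
  J x = begin
    cong (s ∘ r) (cong s (H (r x)))    ≡⟨ cong-∘ (cong s (H (r x))) ⟩
    cong s (cong r (cong s (H (r x)))) ≡⟨ cong (cong s) (cong-∘ (H (r x))) ⟨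
    cong s (cong (r ∘ s) (H (r x)))    ≡⟨ cong (cong s) (cong-≡id H) ⟩
    cong s (H (r (s (r x))))           ∎
    where open ≡-Reasoning

quasiIdempotent-homotopy : {X : Set a} (g f : X → X) → (∀ x → g x ≡ f x) →
                           IsQuasiIdempotent g → IsQuasiIdempotent f
quasiIdempotent-homotopy g f K (I , J) = I' , J'
  where
  K² : ∀ x → g (g x) ≡ f (f x)
  K² x = trans (cong g (K x)) (K (f x))

  I' : ∀ x → f (f x) ≡ f x
  I' x = conj (K² x) (K x) (I x)

  K³-coherence : ∀ x → trans (cong g (K² x)) (K (f (f x)))
                     ≡ trans (cong (g ∘ g) (K x)) (K² (f x))
  K³-coherence x = begin
    trans (cong g (K² x)) (K (f (f x)))
      ≡⟨ cong (λ q → trans q (K (f (f x)))) (trans-cong (cong g (K x))) ⟨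
    trans (trans (cong g (cong g (K x))) (cong g (K (f x)))) (K (f (f x)))
      ≡⟨ trans-assoc (cong g (cong g (K x))) ⟩
    trans (cong g (cong g (K x))) (K² (f x))
      ≡⟨ cong (λ q → trans q (K² (f x))) (cong-∘ (K x)) ⟨
    trans (cong (g ∘ g) (K x)) (K² (f x)) ∎
    where open ≡-Reasoning

  J' : ∀ x → cong f (I' x) ≡ I' (f x)
  J' x = begin
    cong f (I' x)
      ≡⟨ cong-homotopic K (I' x) ⟩
    conj (K (f (f x))) (K (f x)) (cong g (I' x))
      ≡⟨ cong (conj (K (f (f x))) (K (f x))) (cong-conj g (K² x) (K x) (I x)) ⟩
    conj (K (f (f x))) (K (f x)) (conj (cong g (K² x)) (cong g (K x)) (cong g (I x)))
      ≡⟨ conj-conj (K (f (f x))) (K (f x)) (cong g (K² x)) (cong g (K x)) (cong g (I x)) ⟩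
    conj (trans (cong g (K² x)) (K (f (f x)))) (K² x) (cong g (I x))
      ≡⟨ cong₂ (λ α e → conj α (K² x) e) (K³-coherence x) (J x) ⟩
    conj (trans (cong (g ∘ g) (K x)) (K² (f x))) (K² x) (I (g x))
      ≡⟨ conj-conj (K² (f x)) (K (f x)) (cong (g ∘ g) (K x)) (cong g (K x)) (I (g x)) ⟨
    conj (K² (f x)) (K (f x)) (conj (cong (g ∘ g) (K x)) (cong g (K x)) (I (g x)))
      ≡⟨ cong (conj (K² (f x)) (K (f x))) (homotopy-along I (K x)) ⟨
    I' (f x) ∎
    where open ≡-Reasoning

lemma3p6 : ∀ {ℓ ℓ'} {X : Set ℓ} (f : X → X) →
    Σ (Set ℓ') (λ A → Σ (X → A) (λ r → Σ (A → X) (λ s →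
    ((a : A) → r (s a) ≡ a) × ((x : X) → s (r x) ≡ f x)))) →
    IsQuasiIdempotent f
lemma3p6 f (A , r , s , H , K) =
  quasiIdempotent-homotopy (s ∘ r) f K (retract-quasiIdempotent r s H)
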